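{- For all integers $t\ge 2$ and $n\ge 1$, \[ c_t(n)=\sum_{k=1}^{\big\lfloor\frac{n-\binom{t}{2}}{t}\big\rfloor}(t-1)(t+1)^{k-1}c_{t-1}(n-kt), \] where an empty sum is $0$.
   Context: For positive integers $t$ and $m$, define \[ c_t(m)=\sum_{\substack{p_1>\cdots>p_t\ge 1\\ p_1+\cdots+p_t=m}}\frac{1}{t(t+1)}\prod_{i=1}^t\bigg(\frac{i+1}{i}\bigg)^{p_i}, \] the sum being over strictly decreasing sequences of $t$ positive integers summing to $m$ (an empty sum is $0$). -}

module Defs where

open import Data.Nat as ℕ using (ℕ; zero; suc; _>_; _>?_; _≟_)
open import Data.Integer using (+_)
open import Data.Rational using (ℚ; _/_; 0ℚ; 1ℚ; _+_; _*_)
open import Data.List as List using (List; []; _∷_; map; concatMap; filter; upTo; foldr)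
open import Data.List.Relation.Unary.Linked using (Linked; linked?)
open import Data.Product using (_×_)
open import Relation.Binary.PropositionalEquality using (_≡_)
open import Relation.Nullary.Decidable using (Dec; _×-dec_)
open import Data.Nat.ListAction using (sum)

_^ℚ_ : ℚ → ℕ → ℚ
q ^ℚ zero = 1ℚ
q ^ℚ suc n = q * (q ^ℚ n)

sumℚ : List ℚ → ℚ
sumℚ = foldr _+_ 0ℚ

tuples : ℕ → ℕ → List (List ℕ)
tuples zero    m = [] ∷ []
tuples (suc t) m = concatMap (λ p → map (p ∷_) (tuples t m)) (map suc (upTo m))

IsStrictPartition : ℕ → List ℕ → Set
IsStrictPartition m ps = Linked _>_ ps × (sum ps ≡ m)

isStrictPartition? : (m : ℕ) → (ps : List ℕ) → Dec (IsStrictPartition m ps)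
isStrictPartition? m ps = linked? _>?_ ps ×-dec (sum ps ≟ m)

strictPartitions : ℕ → ℕ → List (List ℕ)
strictPartitions t m = filter (isStrictPartition? m) (tuples t m)

weightFrom : ℕ → List ℕ → ℚ
weightFrom j [] = 1ℚ
weightFrom zero (p ∷ ps) = 0ℚ   -- never used (indices start at 1)
weightFrom (suc i) (p ∷ ps) = ((+ suc (suc i) / suc i) ^ℚ p) * weightFrom (suc (suc i)) ps

-- 1 / (t (t+1)); t = 0 never occurs in the statement (convention: 0)
invT : ℕ → ℚ
invT zero = 0ℚ
invT (suc t) = + 1 / (suc t ℕ.* suc (suc t))

c : ℕ → ℕ → ℚ
c t m = sumℚ (map (λ ps → invT t * weightFrom 1 ps) (strictPartitions t m))

-- Let p₁ > ⋯ > pₜ ≥ 1 be a strict partition of n and k = pₜ. Removing k columns of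
-- height t leaves the strict partition q = (p₁ − k, …, pₜ₋₁ − k) of n − kt into t − 1
-- parts, and this is a bijection onto the pairs (k ≥ 1, q). A strict partition into
-- t − 1 parts has sum at least (t choose 2), which gives the range of k.
-- On weights, the columns contribute ∏_{i ≤ t} ((i+1)/i)^k = (t+1)^k by telescoping,
-- and 1/(t(t+1)) · (t+1) = (t−1) · 1/((t−1)t), which yields (t−1)(t+1)^{k−1}.
module Submission where

open import Defs
open import Data.Nat using (ℕ; zero; suc; _≤_; _<_; _>_; z≤n; s≤s; _∸_; _/_; NonZero)
import Data.Nat as ℕ
import Data.Nat.Properties as ℕP
open import Data.Nat.Combinatorics using (_C_; nCk+nC[k+1]≡[n+1]C[k+1]; nC1≡n)
open import Data.Nat.DivMod using (m*n/n≡m; /-monoˡ-≤; m/n*n≤m)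
open import Data.Nat.ListAction using (sum)
open import Data.Nat.Tactic.RingSolver using (solve-∀)
open import Data.Integer using (+_)
import Data.Integer as ℤ
import Data.Integer.Properties as ℤP
open import Data.Rational using (ℚ; _*_; _+_; 1ℚ)
import Data.Rational as ℚ
import Data.Rational.Properties as ℚP
import Data.Rational.Unnormalised as ℚᵘ
import Data.Rational.Unnormalised.Properties as ℚᵘP
import Data.Rational.Solver as ℚSolver
open import Algebra.Bundles using (CommutativeMonoid)
open import Algebra.Properties.CommutativeSemigroup
  (CommutativeMonoid.commutativeSemigroup ℚP.*-1-commutativeMonoid) using (interchange)
open import Data.List using (List; []; _∷_; _∷ʳ_; _++_; map; concatMap; upTo; length)
open import Data.List.Properties
  using (∷-injective; ∷-injectiveˡ; ∷ʳ-injective; map-injective; map-++; map-∘; map-cong; map-cong-local)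
open import Data.List.Relation.Unary.Linked as Linked using (Linked; []; [-]; _∷_)
open import Data.List.Relation.Unary.All as All using (All; []; _∷_)
import Data.List.Relation.Unary.All.Properties as AllP
open import Data.List.Relation.Unary.Any using (here; there)
import Data.List.Relation.Unary.AllPairs as AllPairs
import Data.List.Relation.Unary.AllPairs.Properties as AllPairsP
open import Data.List.Relation.Unary.Unique.Propositional using (Unique)
import Data.List.Relation.Unary.Unique.Propositional.Properties as UniqueP
open import Data.List.Relation.Binary.Disjoint.Propositional using (Disjoint)
open import Data.List.Membership.Propositional using (_∈_)
open import Data.List.Membership.Propositional.Properties
  using (∈-map⁺; ∈-map⁻; ∈-concat⁺′; ∈-concat⁻′; ∈-upTo⁺; ∈-upTo⁻; ∈-filter⁺; ∈-filter⁻)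
open import Data.List.Membership.Propositional.Properties.WithK using (unique∧set⇒bag)
open import Data.List.Relation.Binary.BagAndSetEquality using (∼bag⇒↭)
open import Data.List.Relation.Binary.Permutation.Propositional using (_↭_; ↭⇒↭ₛ)
import Data.List.Relation.Binary.Permutation.Propositional.Properties as ↭P
open import Data.Product using (_×_; _,_; ∃₂; proj₁; proj₂)
open import Function using (_∘_; mk⇔)
open import Relation.Binary.PropositionalEquality as ≡
  using (_≡_; _≢_; refl; sym; trans; cong; cong₂; subst; module ≡-Reasoning)
open import Data.List.Relation.Binary.Permutation.Setoid.Properties (≡.setoid ℚ)
  using (foldr-commMonoid)

addColumns : ℕ → List ℕ → List ℕ
addColumns k q = map (ℕ._+ k) q ∷ʳ k

length-addColumns : ∀ k q → length (addColumns k q) ≡ suc (length q)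
length-addColumns k []      = refl
length-addColumns k (x ∷ q) = cong suc (length-addColumns k q)

sum-addColumns : ∀ k q → sum (addColumns k q) ≡ sum q ℕ.+ k ℕ.* suc (length q)
sum-addColumns k []      = trans (ℕP.+-identityʳ k) (sym (ℕP.*-identityʳ k))
sum-addColumns k (x ∷ q) = trans (cong (x ℕ.+ k ℕ.+_) (sum-addColumns k q)) (regroup x k (sum q) (length q))
  where
  regroup : ∀ x k s l → x ℕ.+ k ℕ.+ (s ℕ.+ k ℕ.* suc l) ≡ x ℕ.+ s ℕ.+ k ℕ.* suc (suc l)
  regroup = solve-∀

addColumns-≥ : ∀ k q → All (k ≤_) (addColumns k q)
addColumns-≥ k []      = ℕP.≤-refl ∷ []
addColumns-≥ k (x ∷ q) = ℕP.m≤n+m k x ∷ addColumns-≥ k q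

addColumns-linked : ∀ k {q} → Linked _>_ q → All (1 ≤_) q → Linked _>_ (addColumns k q)
addColumns-linked k {[]}        _           _           = [-]
addColumns-linked k {x ∷ []}    _           (1≤x ∷ []) = ℕP.m<n+m k 1≤x ∷ [-]
addColumns-linked k {x ∷ y ∷ q} (x>y ∷ y>q) (_ ∷ 1≤y∷q) = ℕP.+-monoˡ-< k x>y ∷ addColumns-linked k y>q 1≤y∷q

addColumns-injective : ∀ {k k′ q q′} → addColumns k q ≡ addColumns k′ q′ → k ≡ k′ × q ≡ q′
addColumns-injective {k} {k′} {q} {q′} eq with ∷ʳ-injective (map (ℕ._+ k) q) (map (ℕ._+ k′) q′) eq
... | raised , refl = refl , map-injective (ℕP.+-cancelʳ-≡ k _ _) raised

private
  ∸-linked : ∀ {p y ys k} q → y ∷ ys ≡ addColumns k q → y < p → Linked _>_ q → Linked _>_ ((p ∸ k) ∷ q)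
  ∸-linked []      _  _   _       = [-]
  ∸-linked (b ∷ q) eq y<p q-linked = ℕP.m+n≤o⇒m≤o∸n (suc b) (subst (_< _) (∷-injectiveˡ eq) y<p) ∷ q-linked

addColumns-surjective : ∀ p ps → Linked _>_ (p ∷ ps) → All (1 ≤_) (p ∷ ps) →
  ∃₂ λ k q → p ∷ ps ≡ addColumns k q × 1 ≤ k × Linked _>_ q × All (1 ≤_) q
addColumns-surjective p []       _             (1≤p ∷ [])    = p , [] , refl , 1≤p , [] , []
addColumns-surjective p (y ∷ ps) (p>y ∷ y>ps) (_ ∷ 1≤y∷ps)
  with addColumns-surjective y ps y>ps 1≤y∷ps
... | k , q , y∷ps≡ , 1≤k , q-linked , q-positive =
  k , (p ∸ k) ∷ q , cong₂ _∷_ (sym (ℕP.m∸n+n≡m (ℕP.<⇒≤ k<p))) y∷ps≡ , 1≤k ,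
  ∸-linked q y∷ps≡ p>y q-linked , ℕP.m+n≤o⇒m≤o∸n 1 k<p ∷ q-positive
  where
  k<p : k < p
  k<p = ℕP.≤-<-trans (All.head (subst (All (k ≤_)) (sym y∷ps≡) (addColumns-≥ k q))) p>y

length<head : ∀ x q → Linked _>_ (x ∷ q) → All (1 ≤_) (x ∷ q) → length q < x
length<head x []      _           (1≤x ∷ [])  = 1≤x
length<head x (y ∷ q) (x>y ∷ y>q) (_ ∷ 1≤y∷q) = ℕP.≤-<-trans (length<head y q y>q 1≤y∷q) x>y

triangular≤sum : ∀ q → Linked _>_ q → All (1 ≤_) q → suc (length q) C 2 ≤ sum q
triangular≤sum []      _      _        = z≤n
triangular≤sum (x ∷ q) linked positive = begin
  suc (suc l) C 2                    ≡⟨ nCk+nC[k+1]≡[n+1]C[k+1] (suc l) 1 ⟨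
  suc l C 1 ℕ.+ suc l C 2            ≡⟨ cong (ℕ._+ suc l C 2) (nC1≡n (suc l)) ⟩
  suc l ℕ.+ suc l C 2                ≤⟨ ℕP.+-mono-≤ (length<head x q linked positive)
                                          (triangular≤sum q (Linked.tail linked) (All.tail positive)) ⟩
  x ℕ.+ sum q                        ∎
  where
  open ℕP.≤-Reasoning
  l = length q

∈⇒≤sum : ∀ {n ns} → n ∈ ns → n ≤ sum ns
∈⇒≤sum {ns = n ∷ ns} (here refl) = ℕP.m≤m+n n (sum ns)
∈⇒≤sum {ns = m ∷ ns} (there n∈)  = ℕP.≤-trans (∈⇒≤sum n∈) (ℕP.m≤n+m (sum ns) m)

concatMap-unique : ∀ {A B : Set} (f : A → List B) {xs} → Unique xs → (∀ x → Unique (f x)) →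
  (∀ {x y} → x ≢ y → Disjoint (f x) (f y)) → Unique (concatMap f xs)
concatMap-unique f xs-unique f-unique disjoint =
  UniqueP.concat⁺ (AllP.map⁺ (All.tabulate (λ {x} _ → f-unique x)))
                  (AllPairsP.map⁺ (AllPairs.map disjoint xs-unique))

∈-tuples⁺ : ∀ {t m ps} → length ps ≡ t → All (λ p → 1 ≤ p × p ≤ m) ps → ps ∈ tuples t m
∈-tuples⁺ {ps = []}                refl []                     = here refl
∈-tuples⁺ {suc t} {m} {suc p ∷ ps} refl ((_ , p<m) ∷ bounds) =
  ∈-concat⁺′ (∈-map⁺ (suc p ∷_) (∈-tuples⁺ refl bounds))
             (∈-map⁺ (λ p → map (p ∷_) (tuples t m)) (∈-map⁺ suc (∈-upTo⁺ p<m)))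

∈-tuples⁻ : ∀ {t m ps} → ps ∈ tuples t m → length ps ≡ t × All (1 ≤_) ps
∈-tuples⁻ {zero} (here refl) = refl , []
∈-tuples⁻ {suc t} {m} mem with ∈-concat⁻′ (map (λ p → map (p ∷_) (tuples t m)) (map suc (upTo m))) mem
... | _ , ps∈ , prefixed∈ with ∈-map⁻ (λ p → map (p ∷_) (tuples t m)) prefixed∈
... | p , p∈ , refl with ∈-map⁻ (p ∷_) ps∈ | ∈-map⁻ suc p∈
... | ps , ps∈tuples , refl | _ , _ , refl with ∈-tuples⁻ ps∈tuples
... | length≡ , positive = cong suc length≡ , s≤s z≤n ∷ positive

tuples-unique : ∀ t m → Unique (tuples t m)
tuples-unique zero    m = [] AllPairs.∷ AllPairs.[]
tuples-unique (suc t) m =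
  concatMap-unique prefixed (UniqueP.map⁺ ℕP.suc-injective (UniqueP.upTo⁺ m))
    (λ p → UniqueP.map⁺ (proj₂ ∘ ∷-injective) (tuples-unique t m)) disjoint
  where
  prefixed : ℕ → List (List ℕ)
  prefixed p = map (p ∷_) (tuples t m)
  disjoint : ∀ {p p′} → p ≢ p′ → Disjoint (prefixed p) (prefixed p′)
  disjoint p≢p′ (ps∈ , ps∈′) with ∈-map⁻ _ ps∈ | ∈-map⁻ _ ps∈′
  ... | _ , _ , refl | _ , _ , eq = p≢p′ (∷-injectiveˡ eq)

∈-strictPartitions⁺ : ∀ {t m ps} → length ps ≡ t → All (1 ≤_) ps → IsStrictPartition m ps →
  ps ∈ strictPartitions t m
∈-strictPartitions⁺ length≡ positive strict@(_ , refl) =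
  ∈-filter⁺ (isStrictPartition? _) (∈-tuples⁺ length≡ (All.zip (positive , All.tabulate ∈⇒≤sum))) strict

∈-strictPartitions⁻ : ∀ t m {ps} → ps ∈ strictPartitions t m →
  length ps ≡ t × All (1 ≤_) ps × IsStrictPartition m ps
∈-strictPartitions⁻ t m mem with ∈-filter⁻ (isStrictPartition? m) mem
... | ps∈tuples , strict with ∈-tuples⁻ ps∈tuples
... | length≡ , positive = length≡ , positive , strict

strictPartitions-unique : ∀ t m → Unique (strictPartitions t m)
strictPartitions-unique t m = UniqueP.filter⁺ (isStrictPartition? m) (tuples-unique t m)

∈-multiplesRange⁺ : ∀ {k m t} .{{_ : NonZero t}} → suc k ℕ.* t ≤ m → suc k ∈ map suc (upTo (m / t))
∈-multiplesRange⁺ {k} {t = t} kt≤m =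
  ∈-map⁺ suc (∈-upTo⁺ (ℕP.≤-trans (ℕP.≤-reflexive (sym (m*n/n≡m (suc k) t))) (/-monoˡ-≤ t kt≤m)))

∈-multiplesRange⁻ : ∀ {k m t} .{{_ : NonZero t}} → k ∈ map suc (upTo (m / t)) → 1 ≤ k × k ℕ.* t ≤ m
∈-multiplesRange⁻ {m = m} {t} k∈ with ∈-map⁻ suc k∈
... | _ , k<m/t , refl = s≤s z≤n , ℕP.≤-trans (ℕP.*-monoˡ-≤ t (∈-upTo⁻ k<m/t)) (m/n*n≤m m t)

addColumns-∈ : ∀ s m {k q} → 1 ≤ k → q ∈ strictPartitions s m →
  addColumns k q ∈ strictPartitions (suc s) (m ℕ.+ k ℕ.* suc s)
addColumns-∈ s m {k} {q} 1≤k q∈ with ∈-strictPartitions⁻ s m q∈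
... | refl , positive , linked , refl =
  ∈-strictPartitions⁺ (length-addColumns k q) (All.map (ℕP.≤-trans 1≤k) (addColumns-≥ k q))
    (addColumns-linked k linked positive , sum-addColumns k q)

strictPartitions-↭ : ∀ s n → strictPartitions (suc s) n ↭
  concatMap (λ k → map (addColumns k) (strictPartitions s (n ∸ k ℕ.* suc s)))
            (map suc (upTo ((n ∸ suc s C 2) / suc s)))
strictPartitions-↭ s n =
  ∼bag⇒↭ (unique∧set⇒bag (strictPartitions-unique t n) withColumns-unique (mk⇔ split join))
  where
  t = suc s
  ks = map suc (upTo ((n ∸ t C 2) / t))

  withColumns : ℕ → List (List ℕ)
  withColumns k = map (addColumns k) (strictPartitions s (n ∸ k ℕ.* t))

  split : ∀ {ps} → ps ∈ strictPartitions t n → ps ∈ concatMap withColumns ks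
  split {[]} mem with () , _ ← ∈-strictPartitions⁻ t n mem
  split {p ∷ ps} mem with ∈-strictPartitions⁻ t n mem
  ... | length≡ , positive , linked , sum≡ with addColumns-surjective p ps linked positive
  ... | suc k , q , p∷ps≡ , s≤s z≤n , q-linked , q-positive =
    subst (_∈ _) (sym p∷ps≡)
      (∈-concat⁺′ (∈-map⁺ (addColumns (suc k)) q∈) (∈-map⁺ withColumns (∈-multiplesRange⁺ kt≤)))
    where
    length-q : length q ≡ s
    length-q = ℕP.suc-injective (begin
      suc (length q)                          ≡⟨ length-addColumns (suc k) q ⟨
      length (addColumns (suc k) q)           ≡⟨ cong length p∷ps≡ ⟨
      length (p ∷ ps)                         ≡⟨ length≡ ⟩
      t                                       ∎)
      where open ≡-Reasoning
    sum-q : sum q ℕ.+ suc k ℕ.* t ≡ n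
    sum-q = begin
      sum q ℕ.+ suc k ℕ.* t                   ≡⟨ cong (λ l → sum q ℕ.+ suc k ℕ.* suc l) length-q ⟨
      sum q ℕ.+ suc k ℕ.* suc (length q)      ≡⟨ sum-addColumns (suc k) q ⟨
      sum (addColumns (suc k) q)              ≡⟨ cong sum p∷ps≡ ⟨
      sum (p ∷ ps)                            ≡⟨ sum≡ ⟩
      n                                       ∎
      where open ≡-Reasoning
    q∈ : q ∈ strictPartitions s (n ∸ suc k ℕ.* t)
    q∈ = ∈-strictPartitions⁺ length-q q-positive
           (q-linked , trans (sym (ℕP.m+n∸n≡m (sum q) (suc k ℕ.* t))) (cong (_∸ suc k ℕ.* t) sum-q))
    kt≤ : suc k ℕ.* t ≤ n ∸ t C 2
    kt≤ = ℕP.m+n≤o⇒m≤o∸n (suc k ℕ.* t) (begin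
      suc k ℕ.* t ℕ.+ t C 2                   ≡⟨ cong (λ l → suc k ℕ.* t ℕ.+ suc l C 2) length-q ⟨
      suc k ℕ.* t ℕ.+ suc (length q) C 2      ≤⟨ ℕP.+-monoʳ-≤ (suc k ℕ.* t) (triangular≤sum q q-linked q-positive) ⟩
      suc k ℕ.* t ℕ.+ sum q                   ≡⟨ ℕP.+-comm (suc k ℕ.* t) (sum q) ⟩
      sum q ℕ.+ suc k ℕ.* t                   ≡⟨ sum-q ⟩
      n                                       ∎)
      where open ℕP.≤-Reasoning

  join : ∀ {ps} → ps ∈ concatMap withColumns ks → ps ∈ strictPartitions t n
  join mem with ∈-concat⁻′ (map withColumns ks) mem
  ... | _ , ps∈ , columns∈ with ∈-map⁻ withColumns columns∈
  ... | k , k∈ , refl with ∈-map⁻ (addColumns k) ps∈ | ∈-multiplesRange⁻ k∈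
  ... | q , q∈ , refl | 1≤k , kt≤ =
    subst (λ m → addColumns k q ∈ strictPartitions t m)
      (ℕP.m∸n+n≡m (ℕP.≤-trans kt≤ (ℕP.m∸n≤m n (t C 2))))
      (addColumns-∈ s (n ∸ k ℕ.* t) 1≤k q∈)

  withColumns-unique : Unique (concatMap withColumns ks)
  withColumns-unique =
    concatMap-unique withColumns (UniqueP.map⁺ ℕP.suc-injective (UniqueP.upTo⁺ ((n ∸ t C 2) / t)))
      (λ k → UniqueP.map⁺ (proj₂ ∘ addColumns-injective {k}) (strictPartitions-unique s (n ∸ k ℕ.* t)))
      disjoint
    where
    disjoint : ∀ {k k′} → k ≢ k′ → Disjoint (withColumns k) (withColumns k′)
    disjoint k≢k′ (ps∈ , ps∈′) with ∈-map⁻ _ ps∈ | ∈-map⁻ _ ps∈′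
    ... | _ , _ , refl | _ , _ , eq = k≢k′ (proj₁ (addColumns-injective eq))

sumℚ-++ : ∀ xs ys → sumℚ (xs ++ ys) ≡ sumℚ xs + sumℚ ys
sumℚ-++ []       ys = sym (ℚP.+-identityˡ (sumℚ ys))
sumℚ-++ (x ∷ xs) ys = trans (cong (λ r → x + r) (sumℚ-++ xs ys)) (sym (ℚP.+-assoc x (sumℚ xs) (sumℚ ys)))

sumℚ-↭ : ∀ {xs ys} → xs ↭ ys → sumℚ xs ≡ sumℚ ys
sumℚ-↭ = foldr-commMonoid ℚP.+-0-isCommutativeMonoid ∘ ↭⇒↭ₛ

sumℚ-concatMap : ∀ {A B : Set} (f : B → ℚ) (g : A → List B) xs →
  sumℚ (map f (concatMap g xs)) ≡ sumℚ (map (λ x → sumℚ (map f (g x))) xs)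
sumℚ-concatMap f g []       = refl
sumℚ-concatMap f g (x ∷ xs) = begin
  sumℚ (map f (g x ++ concatMap g xs))
    ≡⟨ cong sumℚ (map-++ f (g x) (concatMap g xs)) ⟩
  sumℚ (map f (g x) ++ map f (concatMap g xs))
    ≡⟨ sumℚ-++ (map f (g x)) (map f (concatMap g xs)) ⟩
  sumℚ (map f (g x)) + sumℚ (map f (concatMap g xs))
    ≡⟨ cong (λ r → sumℚ (map f (g x)) + r) (sumℚ-concatMap f g xs) ⟩
  sumℚ (map f (g x)) + sumℚ (map (λ x → sumℚ (map f (g x))) xs)
    ∎
  where open ≡-Reasoning

sumℚ-*ˡ : ∀ {A : Set} a (f : A → ℚ) xs → sumℚ (map (λ x → a * f x) xs) ≡ a * sumℚ (map f xs)
sumℚ-*ˡ a f []       = sym (ℚP.*-zeroʳ a)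
sumℚ-*ˡ a f (x ∷ xs) = trans (cong (λ r → a * f x + r) (sumℚ-*ˡ a f xs)) (sym (ℚP.*-distribˡ-+ a (f x) _))

/-cross : ∀ a b c d .{{_ : NonZero b}} .{{_ : NonZero d}} → a ℕ.* d ≡ c ℕ.* b → + a ℚ./ b ≡ + c ℚ./ d
/-cross a (suc b) c (suc d) eq = ℚP.fromℚᵘ-cong {ℚᵘ.mkℚᵘ (+ a) b} {ℚᵘ.mkℚᵘ (+ c) d} (ℚᵘ.*≡* (begin
  + a ℤ.* + suc d    ≡⟨ ℤP.pos-* a (suc d) ⟨
  + (a ℕ.* suc d)    ≡⟨ cong +_ eq ⟩
  + (c ℕ.* suc b)    ≡⟨ ℤP.pos-* c (suc b) ⟩
  + c ℤ.* + suc b    ∎))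
  where open ≡-Reasoning

*-/ : ∀ a b c d .{{_ : NonZero b}} .{{_ : NonZero d}} →
  (+ a ℚ./ b) * (+ c ℚ./ d) ≡ ℚ._/_ (+ (a ℕ.* c)) (b ℕ.* d) {{ℕP.m*n≢0 b d}}
*-/ a b@(suc b-1) c d@(suc d-1) = ℚP.toℚᵘ-injective (begin
  ℚ.toℚᵘ (x * y)                                   ≈⟨ ℚP.toℚᵘ-homo-* x y ⟩
  ℚ.toℚᵘ x ℚᵘ.* ℚ.toℚᵘ y                           ≈⟨ ℚᵘP.*-cong (ℚP.toℚᵘ-fromℚᵘ x′) (ℚP.toℚᵘ-fromℚᵘ y′) ⟩
  ℚᵘ.mkℚᵘ (+ a ℤ.* + c) (ℕ.pred (b ℕ.* d))         ≡⟨ cong (λ n → ℚᵘ.mkℚᵘ n _) (ℤP.pos-* a c) ⟨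
  ℚᵘ.mkℚᵘ (+ (a ℕ.* c)) (ℕ.pred (b ℕ.* d))         ≈⟨ ℚP.toℚᵘ-fromℚᵘ _ ⟨
  ℚ.toℚᵘ (+ (a ℕ.* c) ℚ./ (b ℕ.* d))               ∎)
  where
  open ℚᵘP.≃-Reasoning
  x′ = ℚᵘ.mkℚᵘ (+ a) b-1
  y′ = ℚᵘ.mkℚᵘ (+ c) d-1
  x = + a ℚ./ b
  y = + c ℚ./ d

^ℚ-distribˡ-+-* : ∀ x m n → x ^ℚ (m ℕ.+ n) ≡ x ^ℚ m * x ^ℚ n
^ℚ-distribˡ-+-* x zero    n = sym (ℚP.*-identityˡ (x ^ℚ n))
^ℚ-distribˡ-+-* x (suc m) n = trans (cong (x *_) (^ℚ-distribˡ-+-* x m n)) (sym (ℚP.*-assoc x _ _))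

^ℚ-distribʳ-* : ∀ x y n → (x * y) ^ℚ n ≡ x ^ℚ n * y ^ℚ n
^ℚ-distribʳ-* x y zero    = sym (ℚP.*-identityˡ 1ℚ)
^ℚ-distribʳ-* x y (suc n) = trans (cong (x * y *_) (^ℚ-distribʳ-* x y n)) (interchange x y (x ^ℚ n) (y ^ℚ n))

telescope : ∀ i l → (+ suc (suc i) ℚ./ suc i) * (+ (l ℕ.+ suc (suc (suc i))) ℚ./ suc (suc i))
                  ≡ + (suc l ℕ.+ suc (suc i)) ℚ./ suc i
telescope i l = begin
  (+ v ℚ./ u) * (+ (l ℕ.+ suc v) ℚ./ v)     ≡⟨ *-/ v u (l ℕ.+ suc v) v ⟩
  + (v ℕ.* (l ℕ.+ suc v)) ℚ./ (u ℕ.* v)     ≡⟨ /-cross (v ℕ.* (l ℕ.+ suc v)) (u ℕ.* v) (suc l ℕ.+ v) u (cross i l) ⟩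
  + (suc l ℕ.+ v) ℚ./ u                     ∎
  where
  open ≡-Reasoning
  u = suc i
  v = suc u
  cross : ∀ i l → suc (suc i) ℕ.* (l ℕ.+ suc (suc (suc i))) ℕ.* suc i
                ≡ (suc l ℕ.+ suc (suc i)) ℕ.* (suc i ℕ.* suc (suc i))
  cross = solve-∀

weightFrom-addColumns : ∀ i k q →
  weightFrom (suc i) (addColumns k q) ≡ weightFrom (suc i) q * (+ (length q ℕ.+ suc (suc i)) ℚ./ suc i) ^ℚ k
weightFrom-addColumns i k []      = ℚP.*-comm ((+ suc (suc i) ℚ./ suc i) ^ℚ k) 1ℚ
weightFrom-addColumns i k (p ∷ q) = begin
  r ^ℚ (p ℕ.+ k) * weightFrom (suc (suc i)) (addColumns k q)
    ≡⟨ cong₂ _*_ (^ℚ-distribˡ-+-* r p k) (weightFrom-addColumns (suc i) k q) ⟩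
  (r ^ℚ p * r ^ℚ k) * (w * y ^ℚ k)   ≡⟨ interchange (r ^ℚ p) (r ^ℚ k) w (y ^ℚ k) ⟩
  (r ^ℚ p * w) * (r ^ℚ k * y ^ℚ k)   ≡⟨ cong (r ^ℚ p * w *_) (^ℚ-distribʳ-* r y k) ⟨
  (r ^ℚ p * w) * (r * y) ^ℚ k        ≡⟨ cong (λ z → r ^ℚ p * w * z ^ℚ k) (telescope i (length q)) ⟩
  (r ^ℚ p * w) * (+ (suc (length q) ℕ.+ suc (suc i)) ℚ./ suc i) ^ℚ k ∎
  where
  open ≡-Reasoning
  r = + suc (suc i) ℚ./ suc i
  y = + (length q ℕ.+ suc (suc (suc i))) ℚ./ suc (suc i)
  w = weightFrom (suc (suc i)) q

invT-step : ∀ s → invT (suc (suc s)) * (+ suc (suc (suc s)) ℚ./ 1) ≡ (+ suc s ℚ./ 1) * invT (suc s)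
invT-step s = begin
  invT v * (+ w ℚ./ 1)                  ≡⟨ *-/ 1 (v ℕ.* w) w 1 ⟩
  + (1 ℕ.* w) ℚ./ (v ℕ.* w ℕ.* 1)       ≡⟨ /-cross (1 ℕ.* w) (v ℕ.* w ℕ.* 1) (u ℕ.* 1) (1 ℕ.* (u ℕ.* v)) (cross s) ⟩
  + (u ℕ.* 1) ℚ./ (1 ℕ.* (u ℕ.* v))     ≡⟨ *-/ u 1 1 (u ℕ.* v) ⟨
  (+ u ℚ./ 1) * invT u                  ∎
  where
  open ≡-Reasoning
  u = suc s
  v = suc u
  w = suc v
  cross : ∀ s → 1 ℕ.* suc (suc (suc s)) ℕ.* (1 ℕ.* (suc s ℕ.* suc (suc s)))
              ≡ suc s ℕ.* 1 ℕ.* (suc (suc s) ℕ.* suc (suc (suc s)) ℕ.* 1)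
  cross = solve-∀

weight-addColumns : ∀ s k q → length q ≡ suc s →
  invT (suc (suc s)) * weightFrom 1 (addColumns (suc k) q)
    ≡ (+ suc s ℚ./ 1) * (+ suc (suc (suc s)) ℚ./ 1) ^ℚ k * (invT (suc s) * weightFrom 1 q)
weight-addColumns s k q length≡ = begin
  a * weightFrom 1 (addColumns (suc k) q)
    ≡⟨ cong (a *_) (weightFrom-addColumns 0 (suc k) q) ⟩
  a * (w * (+ (length q ℕ.+ 2) ℚ./ 1) ^ℚ suc k)
    ≡⟨ cong (λ l → a * (w * (+ l ℚ./ 1) ^ℚ suc k)) length+2 ⟩
  a * (w * (x * x ^ℚ k))
    ≡⟨ solve 4 (λ a w x y → a :* (w :* (x :* y)) := a :* x :* (w :* y)) refl a w x (x ^ℚ k) ⟩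
  a * x * (w * x ^ℚ k)
    ≡⟨ cong (_* (w * x ^ℚ k)) (invT-step s) ⟩
  (+ suc s ℚ./ 1) * invT (suc s) * (w * x ^ℚ k)
    ≡⟨ solve 4 (λ b c w y → b :* c :* (w :* y) := b :* y :* (c :* w)) refl (+ suc s ℚ./ 1) (invT (suc s)) w (x ^ℚ k) ⟩
  (+ suc s ℚ./ 1) * x ^ℚ k * (invT (suc s) * w)
    ∎
  where
  open ≡-Reasoning
  open ℚSolver.+-*-Solver
  a = invT (suc (suc s))
  w = weightFrom 1 q
  x = + suc (suc (suc s)) ℚ./ 1
  length+2 : length q ℕ.+ 2 ≡ suc (suc (suc s))
  length+2 = trans (cong (ℕ._+ 2) length≡) (ℕP.+-comm (suc s) 2)

sumℚ-weights-addColumns : ∀ s k m →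
  sumℚ (map (λ ps → invT (suc (suc s)) * weightFrom 1 ps) (map (addColumns (suc k)) (strictPartitions (suc s) m)))
    ≡ (+ suc s ℚ./ 1) * (+ suc (suc (suc s)) ℚ./ 1) ^ℚ k * c (suc s) m
sumℚ-weights-addColumns s k m = begin
  sumℚ (map (λ ps → invT (suc (suc s)) * weightFrom 1 ps) (map (addColumns (suc k)) qs))
    ≡⟨ cong sumℚ (map-∘ qs) ⟨
  sumℚ (map (λ q → invT (suc (suc s)) * weightFrom 1 (addColumns (suc k) q)) qs)
    ≡⟨ cong sumℚ (map-cong-local (All.tabulate (λ {q} q∈ → weight-addColumns s k q (length≡ q∈)))) ⟩
  sumℚ (map (λ q → a * (invT (suc s) * weightFrom 1 q)) qs)
    ≡⟨ sumℚ-*ˡ a (λ q → invT (suc s) * weightFrom 1 q) qs ⟩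
  a * c (suc s) m ∎
  where
  open ≡-Reasoning
  qs = strictPartitions (suc s) m
  length≡ : ∀ {q} → q ∈ qs → length q ≡ suc s
  length≡ = proj₁ ∘ ∈-strictPartitions⁻ (suc s) m
  a = (+ suc s ℚ./ 1) * (+ suc (suc (suc s)) ℚ./ 1) ^ℚ k

proposition3p2 : (t n : ℕ) → 2 ≤ t → 1 ≤ n → .{{_ : NonZero t}} →
    c t n ≡ sumℚ (map (λ k → (+ (t ∸ 1) Data.Rational./ 1) * ((+ (suc t) Data.Rational./ 1) ^ℚ (k ∸ 1)) * c (t ∸ 1) (n ∸ k Data.Nat.* t))
    (map suc (upTo ((n ∸ (t C 2)) / t))))
proposition3p2 t@(suc (suc s)) n (s≤s (s≤s z≤n)) _ = begin
  sumℚ (map weight (strictPartitions t n))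
    ≡⟨ sumℚ-↭ (↭P.map⁺ weight (strictPartitions-↭ (suc s) n)) ⟩
  sumℚ (map weight (concatMap withColumns (map suc range)))
    ≡⟨ sumℚ-concatMap weight withColumns (map suc range) ⟩
  sumℚ (map (sumℚ ∘ map weight ∘ withColumns) (map suc range))
    ≡⟨ cong sumℚ (map-∘ range) ⟨
  sumℚ (map (sumℚ ∘ map weight ∘ withColumns ∘ suc) range)
    ≡⟨ cong sumℚ (map-cong (λ k → sumℚ-weights-addColumns s k (n ∸ suc k ℕ.* t)) range) ⟩
  sumℚ (map (summand ∘ suc) range)
    ≡⟨ cong sumℚ (map-∘ range) ⟩
  sumℚ (map summand (map suc range))
    ∎
  where
  open ≡-Reasoning
  range = upTo ((n ∸ t C 2) / t)
  weight : List ℕ → ℚ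
  weight ps = invT t * weightFrom 1 ps
  withColumns : ℕ → List (List ℕ)
  withColumns k = map (addColumns k) (strictPartitions (suc s) (n ∸ k ℕ.* t))
  summand : ℕ → ℚ
  summand k = (+ suc s ℚ./ 1) * (+ suc t ℚ./ 1) ^ℚ (k ∸ 1) * c (suc s) (n ∸ k ℕ.* t)
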